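{- If $\Sigma$ is a semicomplete weakly distance-regular digraph with girth $3$, then the lexicographic product $\Sigma\circ C_4$ is weakly distance-regular.
   Context: A digraph has a finite vertex set and arcs that are ordered pairs of distinct vertices. $\partial(x,y)$ is the length of a shortest directed path from $x$ to $y$; a digraph is strongly connected if all are finite; the girth is the length of a shortest directed circuit. $\tilde\partial(x,y)=(\partial(x,y),\partial(y,x))$, $\tilde\partial(\Gamma)$ the set of these pairs, $\Gamma_{\tilde i}=\{(x,y):\tilde\partial(x,y)=\tilde i\}$. A strongly connected $\Gamma$ is weakly distance-regular if its arc relation is not symmetric and for all $\tilde i,\tilde j,\tilde h\in\tilde\partial(\Gamma)$ the number $|\{z:(x,z)\in\Gamma_{\tilde i},(z,y)\in\Gamma_{\tilde j}\}|$ is the same for all $(x,y)\in\Gamma_{\tilde h}$. A digraph is semicomplete if for any two distinct vertices $x,y$ at least one of $(x,y),(y,x)$ is an arc. The lexicographic product $\Gamma\circ\Sigma'$ has vertex set $V\Gamma\times V\Sigma'$ with $((u_1,u_2),(v_1,v_2))$ an arc iff $(u_1,v_1)$ is an arc of $\Gamma$, or $u_1=v_1$ and $(u_2,v_2)$ is an arc of $\Sigma'$. $C_4$ is the directed cycle of length 4. -}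

module Defs where

open import Data.Bool using (Bool; true; false; _∧_; _∨_; if_then_else_)
open import Data.Nat using (ℕ; zero; suc; _*_) renaming (_≡ᵇ_ to _≡ᴺ_)
open import Data.Fin using (Fin; zero; suc; remQuot; _≟_)
open import Data.List using (List; length; filterᵇ; allFin)
open import Data.Bool.ListAction using (any)
open import Data.Product using (_×_; _,_; Σ; ∃; ∃-syntax; proj₁; proj₂)
open import Data.Sum using (_⊎_)
open import Relation.Nullary using (¬_)
open import Relation.Nullary.Decidable using (⌊_⌋)
open import Relation.Binary.PropositionalEquality using (_≡_; _≢_)

record Digraph : Set where
  field
    n      : ℕ
    arc    : Fin n → Fin n → Bool
    irrefl : ∀ x → arc x x ≡ false
open Digraph public

Arc : (Γ : Digraph) → Fin (n Γ) → Fin (n Γ) → Set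
Arc Γ x y = arc Γ x y ≡ true

reach : (Γ : Digraph) → ℕ → Fin (n Γ) → Fin (n Γ) → Bool
reach Γ zero    x y = ⌊ x ≟ y ⌋
reach Γ (suc k) x y =
  reach Γ k x y ∨ any (λ z → reach Γ k x z ∧ arc Γ z y) (allFin (n Γ))

-- ∂(x,y): the length of a shortest directed path from x to y.
-- A shortest path has length < n, so searching k = 0 .. n-1 suffices;
-- the value n is returned iff y is unreachable from x (∂ = ∞).
distSearch : (Γ : Digraph) → ℕ → ℕ → Fin (n Γ) → Fin (n Γ) → ℕ
distSearch Γ zero    k x y = k
distSearch Γ (suc f) k x y = if reach Γ k x y then k else distSearch Γ f (suc k) x y

∂ : (Γ : Digraph) → Fin (n Γ) → Fin (n Γ) → ℕ
∂ Γ x y = distSearch Γ (n Γ) 0 x y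

∂̃ : (Γ : Digraph) → Fin (n Γ) → Fin (n Γ) → ℕ × ℕ
∂̃ Γ x y = ∂ Γ x y , ∂ Γ y x

_≡ᵖ_ : ℕ × ℕ → ℕ × ℕ → Bool
(a , b) ≡ᵖ (c , d) = (a ≡ᴺ c) ∧ (b ≡ᴺ d)

StronglyConnected : Digraph → Set
StronglyConnected Γ = ∀ x y → ∃[ k ] (reach Γ k x y ≡ true)

p : (Γ : Digraph) → ℕ × ℕ → ℕ × ℕ → Fin (n Γ) → Fin (n Γ) → ℕ
p Γ i j x y =
  length (filterᵇ (λ z → (∂̃ Γ x z ≡ᵖ i) ∧ (∂̃ Γ z y ≡ᵖ j)) (allFin (n Γ)))

-- Weakly distance-regular.  (Quantifying over all pairs i, j ∈ ℕ × ℕ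
-- rather than only those in ∂̃(Γ) is equivalent: for other i the counts
-- are 0.  The condition "same number for all (x,y) ∈ Γ_h" is stated as:
-- any two pairs with the same ∂̃ give the same count.)
WeaklyDistanceRegular : Digraph → Set
WeaklyDistanceRegular Γ =
  StronglyConnected Γ
  × (∃[ x ] ∃[ y ] (Arc Γ x y × ¬ Arc Γ y x))
  × (∀ (i j : ℕ × ℕ) (x y x′ y′ : Fin (n Γ)) →
       ∂̃ Γ x y ≡ ∂̃ Γ x′ y′ → p Γ i j x y ≡ p Γ i j x′ y′)

Semicomplete : Digraph → Set
Semicomplete Γ = ∀ x y → x ≢ y → Arc Γ x y ⊎ Arc Γ y x

-- Girth 3: there is a directed circuit of length 3 and none of length
-- < 3 (a circuit of length 1 is impossible as there are no loops; a
-- circuit of length 2 is a pair of opposite arcs).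
HasGirth3 : Digraph → Set
HasGirth3 Γ =
  (∃[ x ] ∃[ y ] ∃[ z ] (Arc Γ x y × Arc Γ y z × Arc Γ z x))
  × (∀ x y → ¬ (Arc Γ x y × Arc Γ y x))

next4 : Fin 4 → Fin 4
next4 zero = suc zero
next4 (suc zero) = suc (suc zero)
next4 (suc (suc zero)) = suc (suc (suc zero))
next4 (suc (suc (suc zero))) = zero

C₄ : Digraph
C₄ = record { n = 4 ; arc = λ i j → ⌊ j ≟ next4 i ⌋ ; irrefl = irr }
  where
  irr : ∀ x → ⌊ x ≟ next4 x ⌋ ≡ false
  irr zero = Relation.Binary.PropositionalEquality.refl
  irr (suc zero) = Relation.Binary.PropositionalEquality.refl
  irr (suc (suc zero)) = Relation.Binary.PropositionalEquality.refl
  irr (suc (suc (suc zero))) = Relation.Binary.PropositionalEquality.refl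

lexArc : (Γ Σ′ : Digraph) → Fin (n Γ) × Fin (n Σ′) → Fin (n Γ) × Fin (n Σ′) → Bool
lexArc Γ Σ′ (u₁ , u₂) (v₁ , v₂) = arc Γ u₁ v₁ ∨ (⌊ u₁ ≟ v₁ ⌋ ∧ arc Σ′ u₂ v₂)

lexIrrefl : (Γ Σ′ : Digraph) → ∀ u → lexArc Γ Σ′ u u ≡ false
lexIrrefl Γ Σ′ (u₁ , u₂) rewrite irrefl Γ u₁ | irrefl Σ′ u₂ with ⌊ u₁ ≟ u₁ ⌋
... | true = Relation.Binary.PropositionalEquality.refl
... | false = Relation.Binary.PropositionalEquality.refl

_∘ˡ_ : Digraph → Digraph → Digraph
Γ ∘ˡ Σ′ = record
  { n = n Γ * n Σ′
  ; arc = λ u v → lexArc Γ Σ′ (remQuot (n Σ′) u) (remQuot (n Σ′) v)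
  ; irrefl = λ u → lexIrrefl Γ Σ′ (remQuot (n Σ′) u)
  }

{-# OPTIONS --safe #-}
module Submission where

-- Weak distance-regularity makes all out-degrees of Σ equal, so an arc x → y forces a path
-- y → z → x: otherwise, by semicompleteness and the absence of 2-cycles, every out-neighbour
-- of y would also be one of x, and so would y itself.  Hence distinct vertices u, v of Σ have
-- ∂̃(u,v) ∈ {(1,2),(2,1)}.  In Σ ∘ C₄ a walk leaving a fibre needs at least three steps to come
-- back, so two vertices of one fibre are at the ∂̃ of C₄, which is one of (0,0), (1,3), (2,2),
-- (3,1), and vertices of different fibres are at the ∂̃ of their projections to Σ; in
-- particular ∂̃ tells whether two vertices share a fibre.  Counting z = (w,c) fibre by fibre,
-- each fibre other than those of x and y contributes four times the corresponding count in Σ,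
-- and the fibres of x and y contribute amounts depending only on ∂̃(x,y), because rotating C₄
-- preserves ∂̃.

open import Defs

open import Data.Bool using (Bool; true; false; _∧_; _∨_; if_then_else_)
open import Data.Bool.ListAction using (any)
open import Data.Bool.Properties using (∨-zeroʳ; ∨-identityʳ; ∨-idem; ∧-comm; ∧-idem; T-≡)
open import Data.Empty using (⊥-elim)
open import Data.Fin using (Fin; zero; suc; toℕ; combine; remQuot; _↑ˡ_; _↑ʳ_; _≟_)
open import Data.Fin.Properties
  using (all?; any?; nonZeroIndex; remQuot-combine; combine-remQuot; combine-injectiveˡ; combine-injectiveʳ)
open import Data.List using (length; filterᵇ; tabulate; allFin)
open import Data.List.Membership.Propositional using (lose)
open import Data.List.Membership.Propositional.Properties using (∈-allFin)
open import Data.List.Relation.Unary.Any using (satisfied)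
open import Data.List.Relation.Unary.Any.Properties using (any⁺; any⁻)
open import Data.Nat using (ℕ; zero; suc; _+_; _*_; _≤_; _≰_; _<_; z≤n; s≤s; _≡ᵇ_)
import Data.Nat as ℕ
open import Data.Nat.GeneralisedArithmetic using (iterate)
open import Data.Nat.Properties
  using (+-0-commutativeMonoid; +-*-semiring; +-assoc; +-comm; +-identityʳ; +-suc; *-identityˡ;
         *-identityʳ; +-cancelʳ-≡; +-mono-≤; +-mono-<-≤; +-mono-≤-<; ≤-refl; ≤-trans; ≤-antisym;
         <-irrefl; ≤∧≢⇒<; >⇒≢; n≤0⇒n≡0; m≤n⇒m≤1+n; m≤m+n; m≤n*m)
open import Data.Product using (_×_; _,_; ∃-syntax; Σ-syntax; proj₁; proj₂)
import Data.Product as Product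
open import Data.Product.Properties using (≡-dec)
open import Data.Sum using (_⊎_; inj₁; inj₂)
import Data.Sum as Sum
open import Function using (_∘_; id; case_of_; Equivalence)
open import Relation.Binary.PropositionalEquality
open import Relation.Nullary using (¬_; yes; no; contradiction)
open import Relation.Nullary.Decidable
  using (does; isYes≗does; dec-true; dec-false; from-yes; ¬?; _×-dec_; _→-dec_)

open import Algebra.Properties.CommutativeMonoid.Sum +-0-commutativeMonoid
  using (sum-syntax; ∑-distrib-+; ∑-comm; sum-cong-≗; sum-replicate-zero; sum-init-last)
open import Algebra.Properties.Semiring.Sum +-*-semiring using (*-distribˡ-sum)

𝟙 : Bool → ℕ
𝟙 true  = 1
𝟙 false = 0

𝟙-∧ : ∀ a b → 𝟙 (a ∧ b) ≡ 𝟙 a * 𝟙 b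
𝟙-∧ true  b = sym (*-identityˡ (𝟙 b))
𝟙-∧ false b = refl

count-tabulate : ∀ {A : Set} n (P : A → Bool) (g : Fin n → A) →
                 length (filterᵇ P (tabulate g)) ≡ ∑[ z < n ] 𝟙 (P (g z))
count-tabulate zero    P g = refl
count-tabulate (suc n) P g with P (g zero)
... | true  = cong suc (count-tabulate n P (g ∘ suc))
... | false = count-tabulate n P (g ∘ suc)

count-allFin : ∀ n (P : Fin n → Bool) → length (filterᵇ P (allFin n)) ≡ ∑[ z < n ] 𝟙 (P z)
count-allFin n P = count-tabulate n P id

∑-splitAt : ∀ m n (f : Fin (m + n) → ℕ) →
            ∑[ k < m + n ] f k ≡ ∑[ i < m ] f (i ↑ˡ n) + ∑[ j < n ] f (m ↑ʳ j)
∑-splitAt zero    n f = refl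
∑-splitAt (suc m) n f = trans (cong (f zero +_) (∑-splitAt m n (f ∘ suc))) (sym (+-assoc (f zero) _ _))

∑-combine : ∀ m n (f : Fin (m * n) → ℕ) →
            ∑[ k < m * n ] f k ≡ ∑[ i < m ] ∑[ j < n ] f (combine i j)
∑-combine zero    n f = refl
∑-combine (suc m) n f =
  trans (∑-splitAt n (m * n) f) (cong (∑[ j < n ] f (j ↑ˡ m * n) +_) (∑-combine m n (f ∘ (n ↑ʳ_))))

∑-mono-≤ : ∀ {n} {f g : Fin n → ℕ} → (∀ z → f z ≤ g z) → ∑[ z < n ] f z ≤ ∑[ z < n ] g z
∑-mono-≤ {zero}  f≤g = z≤n
∑-mono-≤ {suc n} f≤g = +-mono-≤ (f≤g zero) (∑-mono-≤ (f≤g ∘ suc))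

∑-mono-< : ∀ {n} {f g : Fin n → ℕ} → (∀ z → f z ≤ g z) → ∀ y → f y < g y →
           ∑[ z < n ] f z < ∑[ z < n ] g z
∑-mono-< f≤g zero    fy<gy = +-mono-<-≤ fy<gy (∑-mono-≤ (f≤g ∘ suc))
∑-mono-< f≤g (suc y) fy<gy = +-mono-≤-< (f≤g zero) (∑-mono-< (f≤g ∘ suc) y fy<gy)

∑-exchange : ∀ {n} (E : Fin n → Bool) (f g : Fin n → ℕ) → (∀ w → E w ≡ false → f w ≡ g w) →
             ∑[ w < n ] f w + ∑[ w < n ] (𝟙 (E w) * g w) ≡ ∑[ w < n ] g w + ∑[ w < n ] (𝟙 (E w) * f w)
∑-exchange {n} E f g f≡g = begin
  ∑[ w < n ] f w + ∑[ w < n ] (𝟙 (E w) * g w)  ≡⟨ ∑-distrib-+ f _ ⟨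
  ∑[ w < n ] (f w + 𝟙 (E w) * g w)            ≡⟨ sum-cong-≗ swap ⟩
  ∑[ w < n ] (g w + 𝟙 (E w) * f w)            ≡⟨ ∑-distrib-+ g _ ⟩
  ∑[ w < n ] g w + ∑[ w < n ] (𝟙 (E w) * f w)  ∎
  where
  open ≡-Reasoning
  swap : ∀ w → f w + 𝟙 (E w) * g w ≡ g w + 𝟙 (E w) * f w
  swap w with E w in e
  ... | true  rewrite *-identityˡ (g w) | *-identityˡ (f w) = +-comm (f w) (g w)
  ... | false = cong (_+ 0) (f≡g w e)

-- Written with `does` rather than `⌊_⌋`: `does (suc w ≟ suc u)` reduces to `does (w ≟ u)`,
-- whereas `⌊ suc w ≟ suc u ⌋` is stuck.
∑-δ : ∀ {n} (u : Fin n) (f : Fin n → ℕ) → ∑[ w < n ] (𝟙 (does (w ≟ u)) * f w) ≡ f u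
∑-δ {suc n} zero    f =
  trans (cong₂ _+_ (*-identityˡ (f zero)) (sum-replicate-zero n)) (+-identityʳ (f zero))
∑-δ {suc n} (suc u) f = ∑-δ u (f ∘ suc)

∑-δ₂ : ∀ {n} {u v : Fin n} (f : Fin n → ℕ) → u ≢ v →
       ∑[ w < n ] (𝟙 (does (w ≟ u) ∨ does (w ≟ v)) * f w) ≡ f u + f v
∑-δ₂ {n} {u} {v} f u≢v =
  trans (sum-cong-≗ split)
    (trans (∑-distrib-+ (λ w → 𝟙 (does (w ≟ u)) * f w) (λ w → 𝟙 (does (w ≟ v)) * f w))
      (cong₂ _+_ (∑-δ u f) (∑-δ v f)))
  where
  split : ∀ w → 𝟙 (does (w ≟ u) ∨ does (w ≟ v)) * f w
              ≡ 𝟙 (does (w ≟ u)) * f w + 𝟙 (does (w ≟ v)) * f w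
  split w with w ≟ u
  ... | no _     = refl
  ... | yes refl rewrite dec-false (w ≟ v) u≢v = sym (+-identityʳ _)

∑-𝟙-≡ᵇ-toℕ : ∀ {k} t → t < k → ∑[ m < k ] 𝟙 (t ≡ᵇ toℕ m) ≡ 1
∑-𝟙-≡ᵇ-toℕ {suc k} zero    _         = cong suc (sum-replicate-zero k)
∑-𝟙-≡ᵇ-toℕ {suc k} (suc t) (s≤s t<k) = ∑-𝟙-≡ᵇ-toℕ t t<k

any-allFin⁺ : ∀ {n} (f : Fin n → Bool) z → f z ≡ true → any f (allFin n) ≡ true
any-allFin⁺ f z fz = Equivalence.to T-≡ (any⁺ f (lose (∈-allFin z) (Equivalence.from T-≡ fz)))

any-allFin⁻ : ∀ {n} (f : Fin n → Bool) → any f (allFin n) ≡ true → ∃[ z ] f z ≡ true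
any-allFin⁻ {n} f e =
  Product.map₂ (Equivalence.to T-≡) (satisfied (any⁻ f (allFin n) (Equivalence.from T-≡ e)))

≢⇒2≤n : ∀ {n} {x y : Fin n} → x ≢ y → 2 ≤ n
≢⇒2≤n {suc zero}    {zero} {zero} x≢y = contradiction refl x≢y
≢⇒2≤n {suc (suc n)}               _   = s≤s (s≤s z≤n)

NoDigon : Digraph → Set
NoDigon Γ = ∀ x y → ¬ (Arc Γ x y × Arc Γ y x)

module _ (Γ : Digraph) where

  arc⇒≢ : ∀ {x y} → Arc Γ x y → x ≢ y
  arc⇒≢ {x} xy refl with () ← trans (sym xy) (irrefl Γ x)

  reach-0⇒≡ : ∀ {x y} → reach Γ 0 x y ≡ true → x ≡ y
  reach-0⇒≡ {x} {y} r with x ≟ y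
  ... | yes x≡y = x≡y

  reach-refl : ∀ k x → reach Γ k x x ≡ true
  reach-refl zero    x = trans (isYes≗does (x ≟ x)) (dec-true (x ≟ x) refl)
  reach-refl (suc k) x rewrite reach-refl k x = refl

  reach-suc : ∀ {k x y} → reach Γ k x y ≡ true → reach Γ (suc k) x y ≡ true
  reach-suc r rewrite r = refl

  reach-step : ∀ {k x y} z → reach Γ k x z ≡ true → Arc Γ z y → reach Γ (suc k) x y ≡ true
  reach-step {k} {x} {y} z r zy =
    trans (cong (reach Γ k x y ∨_) (any-allFin⁺ (λ z → reach Γ k x z ∧ arc Γ z y) z (cong₂ _∧_ r zy)))
          (∨-zeroʳ _)

  reach-suc⁻ : ∀ {k x y} → reach Γ (suc k) x y ≡ true →
               reach Γ k x y ≡ true ⊎ ∃[ z ] (reach Γ k x z ≡ true × Arc Γ z y)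
  reach-suc⁻ {k} {x} {y} r with reach Γ k x y
  ... | true  = inj₁ refl
  ... | false with any-allFin⁻ (λ z → reach Γ k x z ∧ arc Γ z y) r
  ...   | z , rz∧zy = inj₂ (z , ∧-true⁻ rz∧zy)
    where
    ∧-true⁻ : ∀ {a b} → a ∧ b ≡ true → a ≡ true × b ≡ true
    ∧-true⁻ {true} {true} _ = refl , refl

  arc⇒reach : ∀ k {x y} → Arc Γ x y → reach Γ (suc k) x y ≡ true
  arc⇒reach k {x} {y} xy = reach-step {k} {x} {y} x (reach-refl k x) xy

  reach-1⁻ : ∀ {x y} → reach Γ 1 x y ≡ true → x ≡ y ⊎ Arc Γ x y
  reach-1⁻ {x} {y} r with reach-suc⁻ {0} {x} {y} r
  ... | inj₁ r₀            = inj₁ (reach-0⇒≡ r₀)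
  ... | inj₂ (z , r₀ , zy) = inj₂ (subst (λ x → Arc Γ x _) (sym (reach-0⇒≡ r₀)) zy)

  reach-against-arc⇒2≤ : NoDigon Γ → ∀ m {x y} → Arc Γ y x → reach Γ m x y ≡ true → 2 ≤ m
  reach-against-arc⇒2≤ noDigon zero          yx r = contradiction (sym (reach-0⇒≡ r)) (arc⇒≢ yx)
  reach-against-arc⇒2≤ noDigon (suc zero)    yx r with reach-1⁻ r
  ... | inj₁ x≡y = contradiction (sym x≡y) (arc⇒≢ yx)
  ... | inj₂ xy  = contradiction (xy , yx) (noDigon _ _)
  reach-against-arc⇒2≤ noDigon (suc (suc m)) _  _ = s≤s (s≤s z≤n)

  private
    distSearch-≤ : ∀ {x y} f k → distSearch Γ f k x y ≤ k + f
    distSearch-≤ zero    k = m≤m+n k 0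
    distSearch-≤ {x} {y} (suc f) k with reach Γ k x y
    ... | true  = m≤m+n k (suc f)
    ... | false = subst (distSearch Γ f (suc k) x y ≤_) (sym (+-suc k f)) (distSearch-≤ f (suc k))

    distSearch-spec : ∀ {x y} f k →
                      distSearch Γ f k x y ≡ k + f ⊎ reach Γ (distSearch Γ f k x y) x y ≡ true
    distSearch-spec zero    k = inj₁ (sym (+-identityʳ k))
    distSearch-spec {x} {y} (suc f) k with reach Γ k x y in r
    ... | true  = inj₂ r
    ... | false = Sum.map₁ (λ e → trans e (sym (+-suc k f))) (distSearch-spec f (suc k))

    distSearch-least : ∀ {x y m} f k → k ≤ m → reach Γ m x y ≡ true → distSearch Γ f k x y ≤ m
    distSearch-least zero    k k≤m _ = k≤m
    distSearch-least {x} {y} (suc f) k k≤m rm with reach Γ k x y in rk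
    ... | true  = k≤m
    ... | false = distSearch-least f (suc k) (≤∧≢⇒< k≤m k≢m) rm
      where
      k≢m : k ≢ _
      k≢m refl with () ← trans (sym rk) rm

  ∂≤n : ∀ {x y} → ∂ Γ x y ≤ n Γ
  ∂≤n {x} {y} = distSearch-≤ {x} {y} (n Γ) 0

  ∂≡n⊎reach-∂ : ∀ {x y} → ∂ Γ x y ≡ n Γ ⊎ reach Γ (∂ Γ x y) x y ≡ true
  ∂≡n⊎reach-∂ {x} {y} = distSearch-spec {x} {y} (n Γ) 0

  ∂-least : ∀ {x y m} → reach Γ m x y ≡ true → ∂ Γ x y ≤ m
  ∂-least {x} {y} = distSearch-least {x} {y} (n Γ) 0 z≤n

  ∂-unique : ∀ {x y d} → d ≤ n Γ → reach Γ d x y ≡ true →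
             (∀ m → reach Γ m x y ≡ true → d ≤ m) → ∂ Γ x y ≡ d
  ∂-unique {x} {y} d≤n rd least = ≤-antisym (∂-least rd)
    (Sum.[ (λ ∂≡n → subst (_ ≤_) (sym ∂≡n) d≤n) , least _ ]′ (∂≡n⊎reach-∂ {x} {y}))

  ∂-refl : ∀ x → ∂ Γ x x ≡ 0
  ∂-refl x = n≤0⇒n≡0 (∂-least {x} {x} (reach-refl 0 x))

  ∂̃-refl : ∀ x → ∂̃ Γ x x ≡ (0 , 0)
  ∂̃-refl x = cong₂ _,_ (∂-refl x) (∂-refl x)

  ∂̃-diagonal : ∀ x y → ∂̃ Γ x x ≡ ∂̃ Γ y y
  ∂̃-diagonal x y = trans (∂̃-refl x) (sym (∂̃-refl y))

  ∂≡if-arc : ∀ {x y} → x ≢ y → reach Γ 2 x y ≡ true → ∂ Γ x y ≡ (if arc Γ x y then 1 else 2)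
  ∂≡if-arc {x} {y} x≢y r₂ with arc Γ x y in xy
  ... | true  = ∂-unique (≤-trans (s≤s z≤n) (≢⇒2≤n x≢y)) (arc⇒reach 0 xy) λ where
    zero    r → contradiction (reach-0⇒≡ r) x≢y
    (suc m) _ → s≤s z≤n
  ... | false = ∂-unique (≢⇒2≤n x≢y) r₂ λ where
    zero          r → contradiction (reach-0⇒≡ r) x≢y
    (suc zero)    r → Sum.[ (λ x≡y → contradiction x≡y x≢y)
                          , (λ xy′ → case trans (sym xy) xy′ of λ ()) ]′ (reach-1⁻ r)
    (suc (suc m)) _ → s≤s (s≤s z≤n)

  arc⇒∂≡1 : ∀ {x y} → Arc Γ x y → ∂ Γ x y ≡ 1
  arc⇒∂≡1 xy = trans (∂≡if-arc (arc⇒≢ xy) (arc⇒reach 1 xy)) (cong (if_then 1 else 2) xy)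

  ∂≡1⇒arc : ∀ {x y} → ∂ Γ x y ≡ 1 → Arc Γ x y
  ∂≡1⇒arc {x} {y} ∂≡1 with x ≟ y
  ... | yes refl with () ← trans (sym (∂-refl x)) ∂≡1
  ... | no x≢y with ∂≡n⊎reach-∂ {x} {y}
  ...   | inj₁ ∂≡n = contradiction (trans (sym ∂≡n) ∂≡1) (>⇒≢ (≢⇒2≤n x≢y))
  ...   | inj₂ r rewrite ∂≡1 = Sum.[ (λ x≡y → contradiction x≡y x≢y) , id ]′ (reach-1⁻ r)

  arc≡∂≡ᵇ1 : ∀ x y → arc Γ x y ≡ (∂ Γ x y ≡ᵇ 1)
  arc≡∂≡ᵇ1 x y with arc Γ x y in xy
  ... | true  = sym (dec-true (∂ Γ x y ℕ.≟ 1) (arc⇒∂≡1 xy))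
  ... | false = sym (dec-false (∂ Γ x y ℕ.≟ 1)
                               λ ∂≡1 → case trans (sym xy) (∂≡1⇒arc ∂≡1) of λ ())

HasIntersectionNumbers : Digraph → Set
HasIntersectionNumbers Γ = ∀ (i j : ℕ × ℕ) (x y x′ y′ : Fin (n Γ)) →
                           ∂̃ Γ x y ≡ ∂̃ Γ x′ y′ → p Γ i j x y ≡ p Γ i j x′ y′

sphereSize : (Γ : Digraph) → ℕ → Fin (n Γ) → ℕ
sphereSize Γ d x = ∑[ z < n Γ ] 𝟙 (∂ Γ x z ≡ᵇ d)

outdeg : (Γ : Digraph) → Fin (n Γ) → ℕ
outdeg Γ x = ∑[ z < n Γ ] 𝟙 (arc Γ x z)

-- ∂ takes the value n Γ on unreachable pairs, hence the range m ≤ n Γ.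
sphereSize≡∑p : ∀ Γ d x → sphereSize Γ d x ≡ ∑[ m < suc (n Γ) ] p Γ (d , toℕ m) (toℕ m , d) x x
sphereSize≡∑p Γ d x = sym (begin
  ∑[ m < suc N ] p Γ (d , toℕ m) (toℕ m , d) x x
    ≡⟨ sum-cong-≗ {suc N} (λ m → trans (count-allFin N _) (sum-cong-≗ (λ z → split (toℕ m) z))) ⟩
  ∑[ m < suc N ] ∑[ z < N ] (𝟙 (out z) * 𝟙 (back z (toℕ m)))
    ≡⟨ ∑-comm {suc N} {N} (λ m z → 𝟙 (out z) * 𝟙 (back z (toℕ m))) ⟩
  ∑[ z < N ] ∑[ m < suc N ] (𝟙 (out z) * 𝟙 (back z (toℕ m)))
    ≡⟨ sum-cong-≗ (λ z → sym (*-distribˡ-sum {suc N} (𝟙 (out z)) (λ m → 𝟙 (back z (toℕ m))))) ⟩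
  ∑[ z < N ] (𝟙 (out z) * ∑[ m < suc N ] 𝟙 (back z (toℕ m)))
    ≡⟨ sum-cong-≗ (λ z → trans (cong (𝟙 (out z) *_) (∑-𝟙-≡ᵇ-toℕ (∂ Γ z x) (s≤s (∂≤n Γ))))
                                (*-identityʳ _)) ⟩
  sphereSize Γ d x ∎)
  where
  open ≡-Reasoning
  N = n Γ
  out : Fin N → Bool
  out z = ∂ Γ x z ≡ᵇ d
  back : Fin N → ℕ → Bool
  back z m = ∂ Γ z x ≡ᵇ m
  split : ∀ m z → 𝟙 ((out z ∧ back z m) ∧ (back z m ∧ out z)) ≡ 𝟙 (out z) * 𝟙 (back z m)
  split m z = trans (cong 𝟙 (∧-dup (out z) (back z m))) (𝟙-∧ (out z) (back z m))
    where
    ∧-dup : ∀ a b → (a ∧ b) ∧ (b ∧ a) ≡ a ∧ b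
    ∧-dup a b = trans (cong ((a ∧ b) ∧_) (∧-comm b a)) (∧-idem (a ∧ b))

sphereSize-invariant : ∀ {Γ} → HasIntersectionNumbers Γ → ∀ d x y → sphereSize Γ d x ≡ sphereSize Γ d y
sphereSize-invariant {Γ} intersection d x y = begin
  sphereSize Γ d x                                    ≡⟨ sphereSize≡∑p Γ d x ⟩
  ∑[ m < suc (n Γ) ] p Γ (d , toℕ m) (toℕ m , d) x x
    ≡⟨ sum-cong-≗ {suc (n Γ)} (λ m → intersection (d , toℕ m) (toℕ m , d) x x y y (∂̃-diagonal Γ x y)) ⟩
  ∑[ m < suc (n Γ) ] p Γ (d , toℕ m) (toℕ m , d) y y ≡⟨ sphereSize≡∑p Γ d y ⟨
  sphereSize Γ d y                                    ∎
  where open ≡-Reasoning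

outdeg-invariant : ∀ {Γ} → HasIntersectionNumbers Γ → ∀ x y → outdeg Γ x ≡ outdeg Γ y
outdeg-invariant {Γ} intersection x y =
  trans (outdeg≡sphereSize₁ x) (trans (sphereSize-invariant intersection 1 x y) (sym (outdeg≡sphereSize₁ y)))
  where
  outdeg≡sphereSize₁ : ∀ x → outdeg Γ x ≡ sphereSize Γ 1 x
  outdeg≡sphereSize₁ x = sum-cong-≗ (λ z → cong 𝟙 (arc≡∂≡ᵇ1 Γ x z))

module _ (Γ : Digraph) (semicomplete : Semicomplete Γ) (noDigon : NoDigon Γ)
         (regular : ∀ x y → outdeg Γ x ≡ outdeg Γ y) where

  arc⇒reach₂-back : ∀ {x y} → Arc Γ x y → reach Γ 2 y x ≡ true
  arc⇒reach₂-back {x} {y} xy with reach Γ 2 y x in no-return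
  ... | true  = refl
  ... | false = ⊥-elim (<-irrefl (regular y x) (∑-mono-< out-y≤out-x y y-only-from-x))
    where
    out-y≤out-x : ∀ z → 𝟙 (arc Γ y z) ≤ 𝟙 (arc Γ x z)
    out-y≤out-x z with arc Γ y z in yz
    ... | false = z≤n
    ... | true with z ≟ x
    ...   | yes refl = contradiction (xy , yz) (noDigon z y)
    ...   | no z≢x with semicomplete x z (z≢x ∘ sym)
    ...     | inj₁ xz rewrite xz = ≤-refl
    ...     | inj₂ zx with () ← trans (sym no-return) (reach-step Γ {1} {y} {x} z (arc⇒reach Γ 0 yz) zx)
    y-only-from-x : 𝟙 (arc Γ y y) < 𝟙 (arc Γ x y)
    y-only-from-x rewrite irrefl Γ y | xy = s≤s z≤n

  ≢⇒reach₂ : ∀ {x y} → x ≢ y → reach Γ 2 x y ≡ true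
  ≢⇒reach₂ {x} {y} x≢y with semicomplete x y x≢y
  ... | inj₁ xy = arc⇒reach Γ 1 xy
  ... | inj₂ yx = arc⇒reach₂-back yx

  ∂-distinct : ∀ {x y} → x ≢ y → ∂ Γ x y ≡ (if arc Γ x y then 1 else 2)
  ∂-distinct x≢y = ∂≡if-arc Γ x≢y (≢⇒reach₂ x≢y)

  ∂+∂≡3 : ∀ {x y} → x ≢ y → ∂ Γ x y + ∂ Γ y x ≡ 3
  ∂+∂≡3 {x} {y} x≢y rewrite ∂-distinct x≢y | ∂-distinct (x≢y ∘ sym)
    with arc Γ x y in xy | arc Γ y x in yx
  ... | true  | true  = contradiction (xy , yx) (noDigon x y)
  ... | true  | false = refl
  ... | false | true  = refl
  ... | false | false with semicomplete x y x≢y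
  ...   | inj₁ xy′ with () ← trans (sym xy) xy′
  ...   | inj₂ yx′ with () ← trans (sym yx) yx′

-- Decided by evaluation; opaque so that later conversion checks never unfold the decision
-- procedures.
opaque
  C₄-∂̃-next4 : ∀ (a c : Fin 4) → ∂̃ C₄ (next4 a) (next4 c) ≡ ∂̃ C₄ a c
  C₄-∂̃-next4 = from-yes (all? λ a → all? λ c →
    ≡-dec ℕ._≟_ ℕ._≟_ (∂̃ C₄ (next4 a) (next4 c)) (∂̃ C₄ a c))

  C₄-∂̃-rotation : ∀ (a b a′ b′ : Fin 4) → ∂̃ C₄ a b ≡ ∂̃ C₄ a′ b′ →
                  Σ[ k ∈ Fin 4 ] (iterate next4 a (toℕ k) ≡ a′ × iterate next4 b (toℕ k) ≡ b′)
  C₄-∂̃-rotation = from-yes (all? λ a → all? λ b → all? λ a′ → all? λ b′ →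
    ≡-dec ℕ._≟_ ℕ._≟_ (∂̃ C₄ a b) (∂̃ C₄ a′ b′) →-dec
    any? λ (k : Fin 4) → (iterate next4 a (toℕ k) ≟ a′) ×-dec (iterate next4 b (toℕ k) ≟ b′))

  C₄-∂≤3 : ∀ (a b : Fin 4) → ∂ C₄ a b ≤ 3
  C₄-∂≤3 = from-yes (all? λ a → all? λ b → ∂ C₄ a b ℕ.≤? 3)

  C₄-∂+∂≢3 : ∀ (a b : Fin 4) → ∂ C₄ a b + ∂ C₄ b a ≢ 3
  C₄-∂+∂≢3 = from-yes (all? λ a → all? λ b → ¬? (∂ C₄ a b + ∂ C₄ b a ℕ.≟ 3))

C₄-reach-∂ : ∀ a b → reach C₄ (∂ C₄ a b) a b ≡ true
C₄-reach-∂ a b = Sum.[ ∂≢4 , id ]′ (∂≡n⊎reach-∂ C₄ {a} {b})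
  where
  ∂≢4 : ∂ C₄ a b ≡ 4 → reach C₄ (∂ C₄ a b) a b ≡ true
  ∂≢4 ∂≡4 = contradiction (C₄-∂≤3 a b) (subst (_≰ 3) (sym ∂≡4) λ where (s≤s (s≤s (s≤s ()))))

∑-next4 : ∀ (f : Fin 4 → ℕ) → ∑[ c < 4 ] f c ≡ ∑[ c < 4 ] f (next4 c)
∑-next4 f = trans (+-comm (f zero) _) (sym (sum-init-last (f ∘ next4)))

C₄-count : (ℕ × ℕ → ℕ × ℕ → ℕ) → Fin 4 → Fin 4 → ℕ
C₄-count φ a b = ∑[ c < 4 ] φ (∂̃ C₄ a c) (∂̃ C₄ c b)

C₄-count-next4 : ∀ φ a b → C₄-count φ (next4 a) (next4 b) ≡ C₄-count φ a b
C₄-count-next4 φ a b = trans (∑-next4 (λ c → φ (∂̃ C₄ (next4 a) c) (∂̃ C₄ c (next4 b))))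
  (sum-cong-≗ {4} λ c → cong₂ φ (C₄-∂̃-next4 a c) (C₄-∂̃-next4 c b))

C₄-count-iterate : ∀ φ k a b → C₄-count φ (iterate next4 a k) (iterate next4 b k) ≡ C₄-count φ a b
C₄-count-iterate φ zero    a b = refl
C₄-count-iterate φ (suc k) a b = trans (C₄-count-iterate φ k (next4 a) (next4 b)) (C₄-count-next4 φ a b)

C₄-count-∂̃-invariant : ∀ φ a b a′ b′ → ∂̃ C₄ a b ≡ ∂̃ C₄ a′ b′ →
                       C₄-count φ a b ≡ C₄-count φ a′ b′
C₄-count-∂̃-invariant φ a b a′ b′ eq with C₄-∂̃-rotation a b a′ b′ eq
... | k , refl , refl = sym (C₄-count-iterate φ (toℕ k) a b)

χ : ℕ × ℕ → ℕ × ℕ → ℕ × ℕ → ℕ × ℕ → ℕ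
χ i j s t = 𝟙 ((s ≡ᵖ i) ∧ (t ≡ᵖ j))

data CombineView {m k : ℕ} : Fin (m * k) → Set where
  combined : (u : Fin m) (a : Fin k) → CombineView (combine u a)

combineView : ∀ {m} k (X : Fin (m * k)) → CombineView X
combineView {m} k X = subst (CombineView {m} {k}) (combine-remQuot {m} k X)
                            (combined (proj₁ (remQuot {m} k X)) (proj₂ (remQuot {m} k X)))

module Lexicographic (Γ Δ : Digraph) where

  private
    P = Γ ∘ˡ Δ

  arc-combine : ∀ u a v b → arc P (combine u a) (combine v b) ≡ lexArc Γ Δ (u , a) (v , b)
  arc-combine u a v b = cong₂ (lexArc Γ Δ) (remQuot-combine u a) (remQuot-combine v b)

  arc-between : ∀ {u v} a b → u ≢ v → arc P (combine u a) (combine v b) ≡ arc Γ u v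
  arc-between {u} {v} a b u≢v = trans (arc-combine u a v b) lexArc-between
    where
    lexArc-between : lexArc Γ Δ (u , a) (v , b) ≡ arc Γ u v
    lexArc-between with u ≟ v
    ... | yes u≡v = contradiction u≡v u≢v
    ... | no _    = ∨-identityʳ (arc Γ u v)

  arc-within : ∀ u a b → arc P (combine u a) (combine u b) ≡ arc Δ a b
  arc-within u a b = trans (arc-combine u a u b) lexArc-within
    where
    lexArc-within : lexArc Γ Δ (u , a) (u , b) ≡ arc Δ a b
    lexArc-within rewrite irrefl Γ u with u ≟ u
    ... | yes _   = refl
    ... | no u≢u = contradiction refl u≢u

  arc-combine⁻ : ∀ {u a v b} → Arc P (combine u a) (combine v b) → Arc Γ u v ⊎ (u ≡ v × Arc Δ a b)
  arc-combine⁻ {u} {a} {v} {b} uv = lexArc⁻ (trans (sym (arc-combine u a v b)) uv)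
    where
    lexArc⁻ : lexArc Γ Δ (u , a) (v , b) ≡ true → Arc Γ u v ⊎ (u ≡ v × Arc Δ a b)
    lexArc⁻ e with arc Γ u v | u ≟ v
    ... | true  | _       = inj₁ refl
    ... | false | yes u≡v = inj₂ (u≡v , e)

  reach-project : ∀ m u a v b → reach P m (combine u a) (combine v b) ≡ true → reach Γ m u v ≡ true
  reach-project zero    u a v b r =
    subst (λ w → reach Γ 0 u w ≡ true) (combine-injectiveˡ u a v b (reach-0⇒≡ P r)) (reach-refl Γ 0 u)
  reach-project (suc m) u a v b r with reach-suc⁻ P {m} {combine u a} {combine v b} r
  ... | inj₁ r′ = reach-suc Γ {m} (reach-project m u a v b r′)
  ... | inj₂ (Z , rZ , Zv) with combineView {n Γ} (n Δ) Z
  ...   | combined w c with arc-combine⁻ Zv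
  ...     | inj₁ wv         = reach-step Γ {m} w (reach-project m u a w c rZ) wv
  ...     | inj₂ (refl , _) = reach-suc Γ {m} (reach-project m u a w c rZ)

  reach-lift-within : ∀ m (u : Fin (n Γ)) a b → reach Δ m a b ≡ true →
                      reach P m (combine u a) (combine u b) ≡ true
  reach-lift-within zero    u a b r rewrite reach-0⇒≡ Δ r = reach-refl P 0 (combine u b)
  reach-lift-within (suc m) u a b r with reach-suc⁻ Δ {m} {a} {b} r
  ... | inj₁ r′            = reach-suc P {m} (reach-lift-within m u a b r′)
  ... | inj₂ (c , rc , cb) =
    reach-step P {m} (combine u c) (reach-lift-within m u a c rc) (trans (arc-within u c b) cb)

  reach-lift-between : ∀ m u v a b → u ≢ v → reach Γ m u v ≡ true →
                       reach P m (combine u a) (combine v b) ≡ true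
  reach-lift-between zero    u v a b u≢v r = contradiction (reach-0⇒≡ Γ r) u≢v
  reach-lift-between (suc m) u v a b u≢v r with reach-suc⁻ Γ {m} {u} {v} r
  ... | inj₁ r′ = reach-suc P {m} (reach-lift-between m u v a b u≢v r′)
  ... | inj₂ (w , rw , wv) with w ≟ u
  ...   | yes refl = arc⇒reach P m (trans (arc-between a b (arc⇒≢ Γ wv)) wv)
  ...   | no w≢u   = reach-step P {m} (combine w a) (reach-lift-between m u w a a (w≢u ∘ sym) rw)
                                (trans (arc-between a b (arc⇒≢ Γ wv)) wv)

  reach-within⁻ : NoDigon Γ → ∀ m (u : Fin (n Γ)) a b → reach P m (combine u a) (combine u b) ≡ true →
                  reach Δ m a b ≡ true ⊎ 3 ≤ m
  reach-within⁻ noDigon zero    u a b r =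
    inj₁ (subst (λ c → reach Δ 0 a c ≡ true) (combine-injectiveʳ u a u b (reach-0⇒≡ P r))
                (reach-refl Δ 0 a))
  reach-within⁻ noDigon (suc m) u a b r with reach-suc⁻ P {m} {combine u a} {combine u b} r
  ... | inj₁ r′ = Sum.map (reach-suc Δ {m}) m≤n⇒m≤1+n (reach-within⁻ noDigon m u a b r′)
  ... | inj₂ (Z , rZ , Zu) with combineView {n Γ} (n Δ) Z
  ...   | combined w c with arc-combine⁻ Zu
  ...     | inj₁ wu          =
    inj₂ (s≤s (reach-against-arc⇒2≤ Γ noDigon m wu (reach-project m u a w c rZ)))
  ...     | inj₂ (refl , cb) =
    Sum.map (λ rc → reach-step Δ {m} c rc cb) m≤n⇒m≤1+n (reach-within⁻ noDigon m u a c rZ)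

  asymmetric-arc-lift : Fin (n Δ) → ∃[ x ] ∃[ y ] (Arc Γ x y × ¬ Arc Γ y x) →
                        ∃[ X ] ∃[ Y ] (Arc P X Y × ¬ Arc P Y X)
  asymmetric-arc-lift a (x , y , xy , ¬yx) =
    combine x a , combine y a , trans (arc-between a a (arc⇒≢ Γ xy)) xy ,
    ¬yx ∘ trans (sym (arc-between a a (arc⇒≢ Γ xy ∘ sym)))

module LexicographicC₄ (Γ : Digraph) (semicomplete : Semicomplete Γ) (noDigon : NoDigon Γ)
                       (intersection : HasIntersectionNumbers Γ) where

  open Lexicographic Γ C₄

  private
    P = Γ ∘ˡ C₄
    N = n Γ
    regular = outdeg-invariant intersection

  ∂-within : ∀ u a b → ∂ P (combine u a) (combine u b) ≡ ∂ C₄ a b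
  ∂-within u a b =
    ∂-unique P (≤-trans (C₄-∂≤3 a b) 3≤n) (reach-lift-within (∂ C₄ a b) u a b (C₄-reach-∂ a b)) least
    where
    3≤n : 3 ≤ N * 4
    3≤n = ≤-trans (s≤s (s≤s (s≤s z≤n))) (m≤n*m 4 N ⦃ nonZeroIndex u ⦄)
    least : ∀ m → reach P m (combine u a) (combine u b) ≡ true → ∂ C₄ a b ≤ m
    least m r = Sum.[ ∂-least C₄ , ≤-trans (C₄-∂≤3 a b) ]′ (reach-within⁻ noDigon m u a b r)

  ∂-between : ∀ {u v} a b → u ≢ v → ∂ P (combine u a) (combine v b) ≡ ∂ Γ u v
  ∂-between {u} {v} a b u≢v = begin
    ∂ P (combine u a) (combine v b)
      ≡⟨ ∂≡if-arc P (u≢v ∘ combine-injectiveˡ u a v b)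
                    (reach-lift-between 2 u v a b u≢v (≢⇒reach₂ Γ semicomplete noDigon regular u≢v)) ⟩
    (if arc P (combine u a) (combine v b) then 1 else 2) ≡⟨ cong (if_then 1 else 2) (arc-between a b u≢v) ⟩
    (if arc Γ u v then 1 else 2)                         ≡⟨ ∂-distinct Γ semicomplete noDigon regular u≢v ⟨
    ∂ Γ u v                                              ∎
    where open ≡-Reasoning

  ∂̃-within : ∀ u a b → ∂̃ P (combine u a) (combine u b) ≡ ∂̃ C₄ a b
  ∂̃-within u a b = cong₂ _,_ (∂-within u a b) (∂-within u b a)

  ∂̃-between : ∀ {u v} a b → u ≢ v → ∂̃ P (combine u a) (combine v b) ≡ ∂̃ Γ u v
  ∂̃-between a b u≢v = cong₂ _,_ (∂-between a b u≢v) (∂-between b a (u≢v ∘ sym))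

  ∂̃-between≢within : ∀ {u v} a b → u ≢ v → ∂̃ Γ u v ≢ ∂̃ C₄ a b
  ∂̃-between≢within a b u≢v eq = C₄-∂+∂≢3 a b
    (trans (cong (λ d → proj₁ d + proj₂ d) (sym eq)) (∂+∂≡3 Γ semicomplete noDigon regular u≢v))

  fibreCount : ℕ × ℕ → ℕ × ℕ → Fin (n P) → Fin (n P) → Fin N → ℕ
  fibreCount i j X Y w = ∑[ c < 4 ] χ i j (∂̃ P X (combine w c)) (∂̃ P (combine w c) Y)

  p-decomposition : ∀ i j u a v b →
    p P i j (combine u a) (combine v b)
      + ∑[ w < N ] (𝟙 (does (w ≟ u) ∨ does (w ≟ v)) * (4 * χ i j (∂̃ Γ u w) (∂̃ Γ w v)))
    ≡ 4 * p Γ i j u v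
      + ∑[ w < N ] (𝟙 (does (w ≟ u) ∨ does (w ≟ v)) * fibreCount i j (combine u a) (combine v b) w)
  p-decomposition i j u a v b = begin
    p P i j X Y + ∑[ w < N ] (𝟙 (E w) * (4 * G w))
      ≡⟨ cong (_+ ∑[ w < N ] (𝟙 (E w) * (4 * G w))) (trans (count-allFin (N * 4) _) (∑-combine N 4 _)) ⟩
    ∑[ w < N ] fibreCount i j X Y w + ∑[ w < N ] (𝟙 (E w) * (4 * G w))
      ≡⟨ ∑-exchange E (fibreCount i j X Y) (λ w → 4 * G w) outside ⟩
    ∑[ w < N ] (4 * G w) + ∑[ w < N ] (𝟙 (E w) * fibreCount i j X Y w)
      ≡⟨ cong (_+ ∑[ w < N ] (𝟙 (E w) * fibreCount i j X Y w))
              (trans (sym (*-distribˡ-sum 4 G)) (cong (4 *_) (sym (count-allFin N _)))) ⟩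
    4 * p Γ i j u v + ∑[ w < N ] (𝟙 (E w) * fibreCount i j X Y w) ∎
    where
    open ≡-Reasoning
    X = combine u a
    Y = combine v b
    E : Fin N → Bool
    E w = does (w ≟ u) ∨ does (w ≟ v)
    G : Fin N → ℕ
    G w = χ i j (∂̃ Γ u w) (∂̃ Γ w v)
    outside : ∀ w → does (w ≟ u) ∨ does (w ≟ v) ≡ false → fibreCount i j X Y w ≡ 4 * G w
    outside w e with w ≟ u | w ≟ v
    ... | no w≢u | no w≢v =
      sum-cong-≗ {4} λ c → cong₂ (χ i j) (∂̃-between a c (w≢u ∘ sym)) (∂̃-between c b w≢v)

  p-within : ∀ i j u a b →
    p P i j (combine u a) (combine u b) + 4 * χ i j (0 , 0) (0 , 0) ≡ 4 * p Γ i j u u + C₄-count (χ i j) a b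
  p-within i j u a b = begin
    p P i j X Y + 4 * χ i j (0 , 0) (0 , 0)
      ≡⟨ cong (p P i j X Y +_) ends-base ⟨
    p P i j X Y + ∑[ w < N ] (𝟙 (E w) * (4 * χ i j (∂̃ Γ u w) (∂̃ Γ w u)))
      ≡⟨ p-decomposition i j u a u b ⟩
    4 * p Γ i j u u + ∑[ w < N ] (𝟙 (E w) * fibreCount i j X Y w)
      ≡⟨ cong (4 * p Γ i j u u +_) ends-fibre ⟩
    4 * p Γ i j u u + C₄-count (χ i j) a b ∎
    where
    open ≡-Reasoning
    X = combine u a
    Y = combine u b
    E : Fin N → Bool
    E w = does (w ≟ u) ∨ does (w ≟ u)
    at-u : ∀ f → ∑[ w < N ] (𝟙 (E w) * f w) ≡ f u
    at-u f = trans (sum-cong-≗ {N} λ w → cong (λ e → 𝟙 e * f w) (∨-idem (does (w ≟ u)))) (∑-δ u f)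
    ends-base : ∑[ w < N ] (𝟙 (E w) * (4 * χ i j (∂̃ Γ u w) (∂̃ Γ w u))) ≡ 4 * χ i j (0 , 0) (0 , 0)
    ends-base = trans (at-u _) (cong (λ d → 4 * χ i j d d) (∂̃-refl Γ u))
    ends-fibre : ∑[ w < N ] (𝟙 (E w) * fibreCount i j X Y w) ≡ C₄-count (χ i j) a b
    ends-fibre = trans (at-u _) (sum-cong-≗ {4} λ c → cong₂ (χ i j) (∂̃-within u a c) (∂̃-within u c b))

  p-between : ∀ i j {u v} a b {h} → u ≢ v → ∂̃ Γ u v ≡ h →
    p P i j (combine u a) (combine v b) + (4 * χ i j (0 , 0) h + 4 * χ i j h (0 , 0))
    ≡ 4 * p Γ i j u v + (C₄-count (λ s _ → χ i j s h) a a + C₄-count (λ _ t → χ i j h t) b b)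
  p-between i j {u} {v} a b {h} u≢v refl = begin
    p P i j X Y + (4 * χ i j (0 , 0) h + 4 * χ i j h (0 , 0))
      ≡⟨ cong (p P i j X Y +_) ends-base ⟨
    p P i j X Y + ∑[ w < N ] (𝟙 (E w) * (4 * χ i j (∂̃ Γ u w) (∂̃ Γ w v)))
      ≡⟨ p-decomposition i j u a v b ⟩
    4 * p Γ i j u v + ∑[ w < N ] (𝟙 (E w) * fibreCount i j X Y w)
      ≡⟨ cong (4 * p Γ i j u v +_) ends-fibre ⟩
    4 * p Γ i j u v + (C₄-count (λ s _ → χ i j s h) a a + C₄-count (λ _ t → χ i j h t) b b) ∎
    where
    open ≡-Reasoning
    X = combine u a
    Y = combine v b
    E : Fin N → Bool
    E w = does (w ≟ u) ∨ does (w ≟ v)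
    ends-base : ∑[ w < N ] (𝟙 (E w) * (4 * χ i j (∂̃ Γ u w) (∂̃ Γ w v)))
                ≡ 4 * χ i j (0 , 0) h + 4 * χ i j h (0 , 0)
    ends-base = trans (∑-δ₂ _ u≢v)
      (cong₂ _+_ (cong (λ d → 4 * χ i j d h) (∂̃-refl Γ u)) (cong (λ d → 4 * χ i j h d) (∂̃-refl Γ v)))
    ends-fibre : ∑[ w < N ] (𝟙 (E w) * fibreCount i j X Y w)
                 ≡ C₄-count (λ s _ → χ i j s h) a a + C₄-count (λ _ t → χ i j h t) b b
    ends-fibre = trans (∑-δ₂ _ u≢v) (cong₂ _+_
      (sum-cong-≗ {4} λ c → cong₂ (χ i j) (∂̃-within u a c) (∂̃-between c b u≢v))
      (sum-cong-≗ {4} λ c → cong₂ (χ i j) (∂̃-between a c u≢v) (∂̃-within v c b)))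

  p-within-invariant : ∀ i j {u u′ a b a′ b′} → ∂̃ C₄ a b ≡ ∂̃ C₄ a′ b′ →
    p P i j (combine u a) (combine u b) ≡ p P i j (combine u′ a′) (combine u′ b′)
  p-within-invariant i j {u} {u′} {a} {b} {a′} {b′} eq = +-cancelʳ-≡ _ _ _ (begin
    p P i j (combine u a) (combine u b) + 4 * χ i j (0 , 0) (0 , 0)     ≡⟨ p-within i j u a b ⟩
    4 * p Γ i j u u + C₄-count (χ i j) a b
      ≡⟨ cong₂ (λ q c → 4 * q + c) (intersection i j u u u′ u′ (∂̃-diagonal Γ u u′))
                                   (C₄-count-∂̃-invariant (χ i j) a b a′ b′ eq) ⟩
    4 * p Γ i j u′ u′ + C₄-count (χ i j) a′ b′                           ≡⟨ p-within i j u′ a′ b′ ⟨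
    p P i j (combine u′ a′) (combine u′ b′) + 4 * χ i j (0 , 0) (0 , 0) ∎)
    where open ≡-Reasoning

  p-between-invariant : ∀ i j {u v u′ v′} a b a′ b′ → u ≢ v → u′ ≢ v′ → ∂̃ Γ u v ≡ ∂̃ Γ u′ v′ →
    p P i j (combine u a) (combine v b) ≡ p P i j (combine u′ a′) (combine v′ b′)
  p-between-invariant i j {u} {v} {u′} {v′} a b a′ b′ u≢v u′≢v′ eq = +-cancelʳ-≡ _ _ _ (begin
    p P i j (combine u a) (combine v b) + ends                ≡⟨ p-between i j a b u≢v refl ⟩
    4 * p Γ i j u v + (C₄-count φ a a + C₄-count ψ b b)
      ≡⟨ cong₂ (λ q c → 4 * q + c) (intersection i j u v u′ v′ eq)
               (cong₂ _+_ (C₄-count-∂̃-invariant φ a a a′ a′ (∂̃-diagonal C₄ a a′))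
                          (C₄-count-∂̃-invariant ψ b b b′ b′ (∂̃-diagonal C₄ b b′))) ⟩
    4 * p Γ i j u′ v′ + (C₄-count φ a′ a′ + C₄-count ψ b′ b′) ≡⟨ p-between i j a′ b′ u′≢v′ (sym eq) ⟨
    p P i j (combine u′ a′) (combine v′ b′) + ends            ∎)
    where
    open ≡-Reasoning
    h = ∂̃ Γ u v
    ends = 4 * χ i j (0 , 0) h + 4 * χ i j h (0 , 0)
    φ ψ : ℕ × ℕ → ℕ × ℕ → ℕ
    φ s _ = χ i j s h
    ψ _ t = χ i j h t

  intersection-numbers : HasIntersectionNumbers P
  intersection-numbers i j X Y X′ Y′ eq
    with combineView {N} 4 X | combineView {N} 4 Y | combineView {N} 4 X′ | combineView {N} 4 Y′
  ... | combined u a | combined v b | combined u′ a′ | combined v′ b′ with u ≟ v | u′ ≟ v′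
  ...   | yes refl | yes refl =
    p-within-invariant i j (trans (sym (∂̃-within u a b)) (trans eq (∂̃-within u′ a′ b′)))
  ...   | no u≢v   | no u′≢v′ =
    p-between-invariant i j a b a′ b′ u≢v u′≢v′
      (trans (sym (∂̃-between a b u≢v)) (trans eq (∂̃-between a′ b′ u′≢v′)))
  ...   | yes refl | no u′≢v′ = ⊥-elim (∂̃-between≢within a b u′≢v′
    (trans (sym (∂̃-between a′ b′ u′≢v′)) (trans (sym eq) (∂̃-within u a b))))
  ...   | no u≢v   | yes refl = ⊥-elim (∂̃-between≢within a′ b′ u≢v
    (trans (sym (∂̃-between a b u≢v)) (trans eq (∂̃-within u′ a′ b′))))

  strongly-connected : StronglyConnected P
  strongly-connected X Y with combineView {N} 4 X | combineView {N} 4 Y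
  ... | combined u a | combined v b with u ≟ v
  ...   | yes refl = ∂ C₄ a b , reach-lift-within (∂ C₄ a b) u a b (C₄-reach-∂ a b)
  ...   | no u≢v   = 2 , reach-lift-between 2 u v a b u≢v (≢⇒reach₂ Γ semicomplete noDigon regular u≢v)

lemma9p1 : (Σ : Digraph) → Semicomplete Σ → WeaklyDistanceRegular Σ → HasGirth3 Σ
             → WeaklyDistanceRegular (Σ ∘ˡ C₄)
lemma9p1 Σ semicomplete (_ , asymmetric , intersection) (_ , noDigon) =
  strongly-connected , asymmetric-arc-lift zero asymmetric , intersection-numbers
  where
  open Lexicographic Σ C₄ using (asymmetric-arc-lift)
  open LexicographicC₄ Σ semicomplete noDigon intersection
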